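{- Let $\mathbb{K}=(G,M,I,\preceq)$ be an extended formal context, and consider the minimised-return operator $B\mapsto(\underline{B'})'$ on subsets $B\subseteq M$. Then: (i) (non-monotonicity) the operator is not monotone in general: there exist an extended formal context $(G,M,I,\preceq)$ and sets $A\subseteq B\subseteq M$ with $(\underline{A'})'\not\subseteq(\underline{B'})'$; (ii) (extensivity) for every $A\subseteq M$, $A\subseteq(\underline{A'})'$; (iii) (idempotence) for every $A\subseteq M$, $\big(\underline{((\underline{A'})')'}\big)'=(\underline{A'})'$.
   Context: A formal context is a triple $(G,M,I)$ with $G$ a finite non-empty set of objects, $M$ a finite non-empty set of attributes, and $I\subseteq G\times M$. An extended formal context is a quadruple $(G,M,I,\preceq)$ where $(G,M,I)$ is a formal context and $\preceq$ is a partial order on $G$ (read $g\preceq h$ as "$g$ is more preferred/typical than $h$"); $\prec$ denotes its strict part. Derivation operators: for $A\subseteq G$, $A'=\{m\in M\mid \forall g\in A,\ (g,m)\in I\}$; for $B\subseteq M$, $B'=\{g\in G\mid \forall m\in B,\ (g,m)\in I\}$. The minimised derivation of $B\subseteq M$ is $\underline{B'}=\{g\in B'\mid \nexists h\in B' \text{ with } h\prec g\}$, and the minimised-return operator sends $B$ to $(\underline{B'})'\subseteq M$. -}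

module Defs where

open import Level using (0ℓ)
open import Data.Nat using (ℕ; suc)
open import Data.Fin using (Fin; _≟_)
open import Data.Fin.Properties using (all?; any?)
open import Data.Fin.Subset using (Subset; _∈_)
open import Data.Fin.Subset.Properties using (_∈?_)
open import Data.Vec using (tabulate)
open import Data.Product using (_×_)
open import Relation.Binary.Core using (Rel)
open import Relation.Binary.Definitions using (Decidable)
open import Relation.Binary.Structures using (IsDecPartialOrder)
open import Relation.Binary.PropositionalEquality using (_≡_)
open import Relation.Nullary using (¬_; does)
open import Relation.Nullary.Decidable using (_×-dec_; _→-dec_; ¬?)

record ExtContext : Set₁ where
  field
    nG nM   : ℕ
    I       : Fin (suc nG) → Fin (suc nM) → Set
    I?      : Decidable I
    _⪯_     : Rel (Fin (suc nG)) 0ℓ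
    isDecPO : IsDecPartialOrder _≡_ _⪯_

  G = Fin (suc nG)
  M = Fin (suc nM)

  _⪯?_ : Decidable _⪯_
  _⪯?_ = IsDecPartialOrder._≤?_ isDecPO

  _≺_ : Rel G 0ℓ
  h ≺ g = h ⪯ g × ¬ (h ≡ g)

  _≺?_ : Decidable _≺_
  h ≺? g = (h ⪯? g) ×-dec ¬? (h ≟ g)

  objs′ : Subset (suc nG) → Subset (suc nM)
  objs′ A = tabulate λ m → does (all? λ g → (g ∈? A) →-dec I? g m)

  attrs′ : Subset (suc nM) → Subset (suc nG)
  attrs′ B = tabulate λ g → does (all? λ m → (m ∈? B) →-dec I? g m)

  minAttrs′ : Subset (suc nM) → Subset (suc nG)
  minAttrs′ B = tabulate λ g →
    does ((g ∈? attrs′ B) ×-dec ¬? (any? λ h → (h ∈? attrs′ B) ×-dec (h ≺? g)))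

  minReturn : Subset (suc nM) → Subset (suc nM)
  minReturn B = objs′ (minAttrs′ B)

-- Extensivity: every object of min A′ lies in A′, so it has every attribute of A.
-- Idempotence: for C = (min A′)′ we have min A′ ⊆ C′ ⊆ A′. In a finite poset every
-- element of A′ lies above a minimal one, and squeezing a set between A′ and its
-- minimal elements does not change the minimal elements; hence min C′ = min A′.
-- Non-monotonicity: in the two-element chain 0 ≺ 1 with I the identity relation,
-- ∅′ = G has minimum 0, so (min ∅′)′ = {0}, whereas (min {1}′)′ = {1}.
module Submission where

open import Defs
open import Data.Product using (_×_; Σ; ∃-syntax; _,_; proj₁)
open import Data.Nat using (suc)
open import Data.Fin using (Fin; zero; suc; _≟_; _≤_)
open import Data.Fin.Properties using (all?; any?; ≤-isDecTotalOrder)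
open import Data.Fin.Induction using (po-wellFounded)
open import Data.Fin.Subset using (Subset; _⊆_; _∈_; ⁅_⁆) renaming (⊥ to ∅)
open import Data.Fin.Subset.Properties using (_∈?_; ⊆-antisym; ⊆-min)
open import Data.Vec using (tabulate; here)
open import Data.Vec.Properties using ([]=⇒lookup; lookup⇒[]=; lookup∘tabulate)
open import Data.Bool using (true)
open import Data.Bool.Properties using (T-≡)
open import Function using (_∘_)
open import Function.Bundles using (_⇔_; mk⇔; Equivalence)
open import Induction.WellFounded using (Acc; acc)
open import Relation.Binary.Core using (Rel)
open import Relation.Binary.Definitions using (Decidable)
open import Relation.Binary.Structures using (IsDecPartialOrder; IsDecTotalOrder)
import Relation.Binary.Construct.NonStrictToStrict as ToStrict
open import Relation.Binary.PropositionalEquality using (_≡_; cong; sym; trans)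
open import Relation.Nullary using (¬_; yes; no; does)
open import Relation.Nullary.Decidable using (_×-dec_; _→-dec_; ¬?; toWitness; isYes≗does; dec-true)
import Relation.Unary as U

open Equivalence using (to; from)

∈-tabulate-does : ∀ {n p} {P : U.Pred (Fin n) p} (P? : U.Decidable P) {x : Fin n} →
                  x ∈ tabulate (does ∘ P?) ⇔ P x
∈-tabulate-does P? {x} = mk⇔
  (λ x∈ → toWitness {a? = P? x} (from T-≡ (trans (isYes≗does (P? x)) (does-true x∈))))
  (λ Px → lookup⇒[]= x _ (trans (lookup∘tabulate _ x) (dec-true (P? x) Px)))
  where
  does-true : x ∈ tabulate (does ∘ P?) → does (P? x) ≡ true
  does-true x∈ = trans (sym (lookup∘tabulate _ x)) ([]=⇒lookup x∈)

module MinimalElements {n ℓ} {_⪯_ : Rel (Fin n) ℓ} (isDecPO : IsDecPartialOrder _≡_ _⪯_) where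

  open IsDecPartialOrder isDecPO using (isPartialOrder; _≤?_; antisym; ≤-respˡ-≈)
    renaming (refl to ⪯-refl; trans to ⪯-trans)

  _≺_ : Rel (Fin n) ℓ
  _≺_ = ToStrict._<_ _≡_ _⪯_

  _≺?_ : Decidable _≺_
  _≺?_ = ToStrict.<-decidable _≡_ _⪯_ _≟_ _≤?_

  ⪯-≺-trans : ∀ {f g h} → f ⪯ g → g ≺ h → f ≺ h
  ⪯-≺-trans = ToStrict.≤-<-trans _≡_ _⪯_ ⪯-trans antisym ≤-respˡ-≈

  Minimal : Subset n → Fin n → Set ℓ
  Minimal S g = g ∈ S × ¬ (∃[ h ] (h ∈ S × h ≺ g))

  minimal? : ∀ S → U.Decidable (Minimal S)
  minimal? S g = (g ∈? S) ×-dec ¬? (any? λ h → (h ∈? S) ×-dec (h ≺? g))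

  minimal-below : ∀ S {h} → h ∈ S → ∃[ g ] (Minimal S g × g ⪯ h)
  minimal-below S {h} = go (po-wellFounded isPartialOrder h)
    where
    go : ∀ {h} → Acc _≺_ h → h ∈ S → ∃[ g ] (Minimal S g × g ⪯ h)
    go {h} (acc descend) h∈S with any? (λ h′ → (h′ ∈? S) ×-dec (h′ ≺? h))
    ... | no ∄smaller = h , (h∈S , ∄smaller) , ⪯-refl
    ... | yes (h′ , h′∈S , h′≺h) =
      let g , g-minimal , g⪯h′ = go (descend h′≺h) h′∈S
      in  g , g-minimal , ⪯-trans g⪯h′ (proj₁ h′≺h)

  minimal-squeeze : ∀ {S T} → S ⊆ T → (∀ {g} → Minimal T g → g ∈ S) →
                    ∀ {g} → Minimal S g ⇔ Minimal T g
  minimal-squeeze {S} {T} S⊆T minT⊆S = mk⇔ S-minimal⇒T-minimal T-minimal⇒S-minimal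
    where
    S-minimal⇒T-minimal : ∀ {g} → Minimal S g → Minimal T g
    S-minimal⇒T-minimal (g∈S , ∄S) = S⊆T g∈S , λ (h , h∈T , h≺g) →
      let h₀ , h₀-minimal , h₀⪯h = minimal-below T h∈T
      in  ∄S (h₀ , minT⊆S h₀-minimal , ⪯-≺-trans h₀⪯h h≺g)

    T-minimal⇒S-minimal : ∀ {g} → Minimal T g → Minimal S g
    T-minimal⇒S-minimal g-minimal@(_ , ∄T) = minT⊆S g-minimal , λ (h , h∈S , h≺g) →
      ∄T (h , S⊆T h∈S , h≺g)

module _ (K : ExtContext) where

  open ExtContext K hiding (_≺_; _≺?_)
  open MinimalElements isDecPO

  ∈-attrs′ : ∀ {B g} → g ∈ attrs′ B ⇔ (∀ m → m ∈ B → I g m)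
  ∈-attrs′ {B} = ∈-tabulate-does λ g → all? λ m → (m ∈? B) →-dec I? g m

  ∈-objs′ : ∀ {A m} → m ∈ objs′ A ⇔ (∀ g → g ∈ A → I g m)
  ∈-objs′ {A} = ∈-tabulate-does λ m → all? λ g → (g ∈? A) →-dec I? g m

  ∈-minAttrs′ : ∀ B {g} → g ∈ minAttrs′ B ⇔ Minimal (attrs′ B) g
  ∈-minAttrs′ B = ∈-tabulate-does (minimal? (attrs′ B))

  minAttrs′⊆attrs′ : ∀ {B} → minAttrs′ B ⊆ attrs′ B
  minAttrs′⊆attrs′ {B} = proj₁ ∘ to (∈-minAttrs′ B)

  attrs′-antitone : ∀ {B C} → B ⊆ C → attrs′ C ⊆ attrs′ B
  attrs′-antitone B⊆C g∈ = from ∈-attrs′ λ m m∈B → to ∈-attrs′ g∈ m (B⊆C m∈B)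

  objs′-antitone : ∀ {A D} → A ⊆ D → objs′ D ⊆ objs′ A
  objs′-antitone A⊆D m∈ = from ∈-objs′ λ g g∈A → to ∈-objs′ m∈ g (A⊆D g∈A)

  ⊆-attrs′∘objs′ : ∀ {A} → A ⊆ attrs′ (objs′ A)
  ⊆-attrs′∘objs′ g∈A = from ∈-attrs′ λ m m∈ → to ∈-objs′ m∈ _ g∈A

  ⊆-objs′∘attrs′ : ∀ {B} → B ⊆ objs′ (attrs′ B)
  ⊆-objs′∘attrs′ m∈B = from ∈-objs′ λ g g∈ → to ∈-attrs′ g∈ _ m∈B

  minReturn-extensive : ∀ A → A ⊆ minReturn A
  minReturn-extensive A = objs′-antitone minAttrs′⊆attrs′ ∘ ⊆-objs′∘attrs′

  minAttrs′-minReturn : ∀ A → minAttrs′ (minReturn A) ≡ minAttrs′ A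
  minAttrs′-minReturn A = ⊆-antisym
    (λ g∈ → from (∈-minAttrs′ A) (to squeeze (to (∈-minAttrs′ (minReturn A)) g∈)))
    (λ g∈ → from (∈-minAttrs′ (minReturn A)) (from squeeze (to (∈-minAttrs′ A) g∈)))
    where
    squeeze : ∀ {g} → Minimal (attrs′ (minReturn A)) g ⇔ Minimal (attrs′ A) g
    squeeze = minimal-squeeze (attrs′-antitone (minReturn-extensive A))
                              (⊆-attrs′∘objs′ ∘ from (∈-minAttrs′ A))

  minReturn-idempotent : ∀ A → minReturn (minReturn A) ≡ minReturn A
  minReturn-idempotent A = cong objs′ (minAttrs′-minReturn A)

open ExtContext using (nM; minReturn)

twoChain : ExtContext
twoChain = record
  { nG = 1 ; nM = 1
  ; I = _≡_ ; I? = _≟_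
  ; _⪯_ = _≤_ ; isDecPO = IsDecTotalOrder.isDecPartialOrder ≤-isDecTotalOrder
  }

minReturn-not-monotone : ¬ (minReturn twoChain ∅ ⊆ minReturn twoChain ⁅ suc zero ⁆)
minReturn-not-monotone mono with () ← mono here

theorem1 : (∃[ K ] Σ (Subset (suc (nM K))) λ A → Σ (Subset (suc (nM K))) λ B → A ⊆ B × ¬ (minReturn K A ⊆ minReturn K B))
    × ((K : ExtContext) (A : Subset (suc (nM K))) → A ⊆ minReturn K A)
    × ((K : ExtContext) (A : Subset (suc (nM K))) → minReturn K (minReturn K A) ≡ minReturn K A)
theorem1 = (twoChain , ∅ , ⁅ suc zero ⁆ , ⊆-min _ , minReturn-not-monotone)
         , minReturn-extensive
         , minReturn-idempotent
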